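{- Let $G$ be a finite graph, $\vec S$ the universe of separations of $G$, and $\mathcal F$ an $S$-stable family of stars (finite multisets of elements of $\vec S$). If $(T,\alpha)$ is a tame $S$-tree over $\mathcal F$ which is $\mathcal F$-lean, then the tree-decomposition $(T,\mathcal V)_\alpha$ (with bags $V_t=\mathrm{int}(\sigma_t)$) is lean, i.e. for all $m\in\mathbb N$, all $t,t'\in V(T)$ and all $Z_1\subseteq V_t$, $Z_2\subseteq V_{t'}$ with $|Z_1|=|Z_2|=m$, either $G$ contains $m$ disjoint $Z_1$–$Z_2$ paths or there is an edge $ss'$ on the path $tTt'$ with $|V_s\cap V_{s'}|<m$.
   Context: The universe of separations of $G$ is the set $\vec S$ of ordered pairs $(A,B)$ of subsets of $V(G)$ with $A\cup B=V(G)$ and no edge of $G$ between $A\setminus B$ and $B\setminus A$; it is ordered by $(A,B)\le(C,D)$ iff $A\subseteq C$ and $B\supseteq D$, with involution $(A,B)^*=(B,A)$, and carries the order function $|A,B|=|A\cap B|$ (this is $|A,B|_r=r(A)+r(B)-r(V(G))$ for $r(X)=|X|$). For $(A,B)\le(C,D)$, $\lambda((A,B),(C,D))=\min\{|X\cap Y|:(X,Y)\in\vec S,(A,B)\le(X,Y)\le(C,D)\}$. A star is a finite multiset $\sigma$ of separations such that any two of its members (distinct as members of the multiset) $(A,B),(C,D)$ satisfy $(A,B)\le(D,C)$; for $\sigma=\{(A_0,B_0),\dots,(A_n,B_n)\}$, $\mathrm{int}(\sigma)=\bigcap_iB_i$. $\mathcal F$ is $S$-stable if whenever $\sigma\in\mathcal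 F$ and $(A,B)\in\vec S$ with $\sigma\cup\{(A,B)\}$ a star, then $\sigma\cup\{(A,B)\}\in\mathcal F$. An $S$-tree is a pair $(T,\alpha)$ with $T$ a finite tree and $\alpha$ a map from the set $\vec E(T)$ of oriented edges $(x,y)$ of $T$ to $\vec S$ with $\alpha(y,x)=\alpha(x,y)^*$. For $t\in V(T)$, $\vec F_t=\{(x,t)\in\vec E(T)\}$ and $\sigma_t=\alpha(\vec F_t)$ as a multiset; the tree is tame if every $\sigma_t$ is a star, and over $\mathcal F$ if every $\sigma_t\in\mathcal F$. A separation $(A,B)$ is addable at $t$ if $\sigma_t\cup\{(A,B)\}\in\mathcal F$. The tree is $\mathcal F$-lean if for every pair of vertices $t,t'$ and every pair of separations $(A,B)\le(B',A')$ in $\vec S$ with $(A,B)$ addable at $t$ and $(A',B')$ addable at $t'$, either $\lambda((A,B),(B',A'))\ge\min\{|A|,|A'|\}$ or $\min\{|\alpha(\vec g)|:\vec g$ an edge of the path $tTt'$ oriented towards $t'\}=\lambda((A,B),(B',A'))$ (the minimum over the empty set, when $t=t'$, being $+\infty$). -}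

module Defs where

open import Data.Nat using (ℕ; _≤_; _<_; _⊓_)
open import Data.Bool using (Bool; true; false)
open import Data.Fin using (Fin)
open import Data.Fin.Subset using (Subset; _∈_; _∉_; _⊆_; _∩_; _∪_; ⊤; ∣_∣)
open import Data.List using (List; []; _∷_; length; map; filterᵇ; head; last; zip; lookup; reverse)
open import Data.List.Relation.Unary.All using (All)
open import Data.List.Relation.Unary.Any using (Any)
open import Data.List.Relation.Unary.Linked using (Linked)
open import Data.List.Relation.Unary.Unique.Propositional using (Unique)
open import Data.List.Relation.Binary.Permutation.Propositional using (_↭_)
open import Data.Vec as Vec using (Vec)
open import Data.Empty using (⊥)
open import Data.Product using (Σ; ∃; _×_; _,_; proj₁; proj₂; swap)
open import Data.Sum using (_⊎_)
open import Data.Maybe using (Maybe; just)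
open import Relation.Nullary using (¬_)
open import Relation.Binary.PropositionalEquality using (_≡_; _≢_)
open import Data.List.Base using (allFin)

record Graph (n : ℕ) : Set where
  field
    adj       : Fin n → Fin n → Bool
    adj-sym   : ∀ x y → adj x y ≡ adj y x
    adj-irref : ∀ x → adj x x ≡ false

Edge : ∀ {n} → Graph n → Fin n → Fin n → Set
Edge G x y = Graph.adj G x y ≡ true

IsPath : ∀ {n} → Graph n → List (Fin n) → Set
IsPath G P = Unique P × Linked (Edge G) P

StartsIn : ∀ {n} → Subset n → List (Fin n) → Set
StartsIn Z []       = ⊥
StartsIn Z (x ∷ xs) = x ∈ Z × All (λ v → v ∉ Z) xs

-- Z₁–Z₂ path (Diestel): V(P) ∩ Z₁ = {x₀}, V(P) ∩ Z₂ = {x_k}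
IsABPath : ∀ {n} → Graph n → Subset n → Subset n → List (Fin n) → Set
IsABPath G Z₁ Z₂ P = IsPath G P × StartsIn Z₁ P × StartsIn Z₂ (reverse P)

Disjoint : ∀ {n} → List (Fin n) → List (Fin n) → Set
Disjoint P Q = All (λ v → All (λ w → v ≢ w) Q) P

HasDisjointPaths : ∀ {n} → Graph n → ℕ → Subset n → Subset n → Set
HasDisjointPaths {n} G m Z₁ Z₂ =
  Σ (Vec (List (Fin n)) m) λ Ps →
    (∀ i → IsABPath G Z₁ Z₂ (Vec.lookup Ps i)) ×
    (∀ i j → i ≢ j → Disjoint (Vec.lookup Ps i) (Vec.lookup Ps j))

Sepn : ℕ → Set
Sepn n = Subset n × Subset n

IsSep : ∀ {n} → Graph n → Sepn n → Set
IsSep G (A , B) =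
  (A ∪ B ≡ ⊤) ×
  (∀ x y → x ∈ A → x ∉ B → y ∈ B → y ∉ A → ¬ Edge G x y)

_≤ˢ_ : ∀ {n} → Sepn n → Sepn n → Set
(A , B) ≤ˢ (C , D) = (A ⊆ C) × (D ⊆ B)

infix 30 _*
infix 4 _≤ˢ_
_* : ∀ {n} → Sepn n → Sepn n
s * = swap s

ord : ∀ {n} → Sepn n → ℕ
ord (A , B) = ∣ A ∩ B ∣

IsLambda : ∀ {n} → Graph n → Sepn n → Sepn n → ℕ → Set
IsLambda G s₁ s₂ l =
  (∃ λ s → IsSep G s × s₁ ≤ˢ s × s ≤ˢ s₂ × ord s ≡ l) ×
  (∀ s → IsSep G s → s₁ ≤ˢ s → s ≤ˢ s₂ → l ≤ ord s)

IsStar : ∀ {n} → Graph n → List (Sepn n) → Set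
IsStar G σ =
  All (IsSep G) σ ×
  (∀ i j → i ≢ j → lookup σ i ≤ˢ (lookup σ j) *)

int : ∀ {n} → List (Sepn n) → Subset n
int []             = ⊤
int ((A , B) ∷ σ)  = B ∩ int σ

-- a family of stars: a predicate on multisets (lists up to permutation)
-- all of whose members are stars
record FamilyOfStars {n} (G : Graph n) : Set₁ where
  field
    mem      : List (Sepn n) → Set
    perm     : ∀ {σ τ} → σ ↭ τ → mem σ → mem τ
    isStar   : ∀ σ → mem σ → IsStar G σ

IsStable : ∀ {n} {G : Graph n} → FamilyOfStars G → Set
IsStable {G = G} 𝓕 = ∀ σ s → FamilyOfStars.mem 𝓕 σ → IsSep G s →
  IsStar G (s ∷ σ) → FamilyOfStars.mem 𝓕 (s ∷ σ)

record Tree (k : ℕ) : Set where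
  field
    tadj       : Fin k → Fin k → Bool
    tadj-sym   : ∀ x y → tadj x y ≡ tadj y x
    tadj-irref : ∀ x → tadj x x ≡ false

  TEdge : Fin k → Fin k → Set
  TEdge x y = tadj x y ≡ true

  TPath : Fin k → Fin k → List (Fin k) → Set
  TPath t t' P = Unique P × Linked TEdge P × head P ≡ just t × last P ≡ just t'

  field
    connected   : ∀ t t' → ∃ λ P → TPath t t' P
    uniquePaths : ∀ t t' P Q → TPath t t' P → TPath t t' Q → P ≡ Q

  nbrs : Fin k → List (Fin k)
  nbrs t = filterᵇ (λ x → tadj x t) (allFin k)

consec : ∀ {A : Set} → List A → List (A × A)
consec []       = []
consec (x ∷ xs) = zip (x ∷ xs) xs

-- α is given on all ordered pairs; only its values on oriented edges matter
record STree {n} (G : Graph n) (k : ℕ) : Set where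
  field
    T      : Tree k
    α      : Fin k → Fin k → Sepn n
  open Tree T public
  field
    α-sep  : ∀ x y → TEdge x y → IsSep G (α x y)
    α-inv  : ∀ x y → TEdge x y → α y x ≡ (α x y) *

  σ : Fin k → List (Sepn n)
  σ t = map (λ x → α x t) (nbrs t)

  V : Fin k → Subset n
  V t = int (σ t)

  PathMin : List (Fin k) → ℕ → Set
  PathMin P l = Any (λ e → ord (α (proj₁ e) (proj₂ e)) ≡ l) (consec P) ×
                All (λ e → l ≤ ord (α (proj₁ e) (proj₂ e))) (consec P)

module _ {n} {G : Graph n} {k : ℕ} where

  IsTame : STree G k → Set
  IsTame 𝒯 = ∀ t → IsStar G (STree.σ 𝒯 t)

  IsOver : STree G k → FamilyOfStars G → Set
  IsOver 𝒯 𝓕 = ∀ t → FamilyOfStars.mem 𝓕 (STree.σ 𝒯 t)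

  Addable : STree G k → FamilyOfStars G → Fin k → Sepn n → Set
  Addable 𝒯 𝓕 t s = FamilyOfStars.mem 𝓕 (s ∷ STree.σ 𝒯 t)

  IsFLean : STree G k → FamilyOfStars G → Set
  IsFLean 𝒯 𝓕 = ∀ t t' (A B A' B' : Subset n) →
    IsSep G (A , B) → IsSep G (A' , B') →
    (A , B) ≤ˢ (B' , A') →
    Addable 𝒯 𝓕 t (A , B) → Addable 𝒯 𝓕 t' (A' , B') →
    ∀ l → IsLambda G (A , B) (B' , A') l →
    (∣ A ∣ ⊓ ∣ A' ∣ ≤ l) ⊎
    (∀ P → STree.TPath 𝒯 t t' P → STree.PathMin 𝒯 P l)

  IsLeanTD : STree G k → Set
  IsLeanTD 𝒯 = ∀ (m : ℕ) (t t' : Fin k) (Z₁ Z₂ : Subset n) →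
    Z₁ ⊆ V t → Z₂ ⊆ V t' → ∣ Z₁ ∣ ≡ m → ∣ Z₂ ∣ ≡ m →
    ∀ P → TPath t t' P →
    HasDisjointPaths G m Z₁ Z₂ ⊎
    Any (λ e → ∣ V (proj₁ e) ∩ V (proj₂ e) ∣ < m) (consec P)
    where open STree 𝒯

-- If there are no m disjoint Z₁–Z₂ paths, Menger's theorem gives a separation (X,Y) of order < m
-- with Z₁ ⊆ X and Z₂ ⊆ Y.  It lies between (Z₁,V) and (V,Z₂), which are addable at t and t' by
-- stability (Zᵢ lies in the bag, so the star σ_t extends by (Zᵢ,V)); hence
-- λ((Z₁,V),(V,Z₂)) < m = min(|Z₁|,|Z₂|).  𝓕-leanness then yields an edge ss' of tTt' whose
-- separation has order λ < m, and V_s ∩ V_s' lies in the separator of that edge.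
--
-- Menger's theorem is proved for digraphs by induction on the number of arcs (Diestel's first
-- proof): delete an arc xy; a small separation (X,Y) of the smaller digraph either remains one,
-- or xy crosses it, and then both S_x = (X∩Y)+x and S_y = (X∩Y)+y have at most m vertices, so
-- m paths A → S_x and m paths S_y → B can be paired up and concatenated.

module Submission where

open import Defs
open import Data.Nat using (ℕ; zero; suc; _≤_; _<_; z≤n; s≤s; _+_; _⊓_)
open import Data.Nat.Properties hiding (_≟_)
open import Data.Nat.Induction using (<-wellFounded)
open import Induction.WellFounded using (Acc; acc)
open import Data.Bool using (Bool; true; false; if_then_else_)
import Data.Bool as Bool
open import Data.Fin using (Fin; zero; suc; _≟_)
import Data.Fin.Properties as Fin
open import Data.Fin.Subset using (Subset; inside; outside; _∈_; _∉_; _⊆_; _∩_; _∪_; ⊤; ∁; ⁅_⁆; ∣_∣; _-_)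
open import Data.Fin.Subset.Properties
open import Data.Vec as Vec using ([]; _∷_; here; there)
import Data.Vec.Properties as Vec
open import Data.List using (List; []; _∷_; _++_; _∷ʳ_; [_]; reverse; lookup)
open import Data.List.Properties using (reverse-++; unfold-reverse)
open import Data.List.Relation.Unary.All as All using (All; []; _∷_)
import Data.List.Relation.Unary.All.Properties as All
open import Data.List.Relation.Unary.AllPairs using ([]; _∷_)
import Data.List.Relation.Unary.AllPairs.Properties as AllPairs
open import Data.List.Relation.Unary.Any as Any using (Any; here; there)
open import Data.List.Relation.Unary.Linked as Linked using (Linked; [-]; _∷_)
open import Data.List.Relation.Unary.Unique.Propositional using (Unique)
open import Data.List.Membership.Propositional using () renaming (_∈_ to _∈ₗ_)
open import Data.List.Membership.Propositional.Properties
  using (∈-++⁻; ∈-++⁺ˡ; ∈-++⁺ʳ; ∈-filter⁺; ∈-allFin; ∈-lookup; ∈-map⁺)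
open import Data.Product using (Σ; ∃; _×_; _,_; proj₁; proj₂)
open import Data.Sum as Sum using (_⊎_; inj₁; inj₂)
open import Data.Empty using (⊥; ⊥-elim)
open import Data.Unit using (tt)
open import Relation.Nullary using (¬_; Dec; yes; no; contradiction)
open import Relation.Nullary.Decidable using (_×-dec_; _→-dec_; ¬?)
open import Relation.Binary.PropositionalEquality hiding ([_])
open import Function using (_∘_; case_of_)
open import Function.Definitions using (Injective)

private variable n : ℕ

∣p∪q∣≤∣p∣+∣q∣ : ∀ (p q : Subset n) → ∣ p ∪ q ∣ ≤ ∣ p ∣ + ∣ q ∣
∣p∪q∣≤∣p∣+∣q∣ [] [] = z≤n
∣p∪q∣≤∣p∣+∣q∣ (inside ∷ p) (inside ∷ q) =
  s≤s (≤-trans (∣p∪q∣≤∣p∣+∣q∣ p q) (+-monoʳ-≤ ∣ p ∣ (n≤1+n ∣ q ∣)))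
∣p∪q∣≤∣p∣+∣q∣ (inside ∷ p) (outside ∷ q) = s≤s (∣p∪q∣≤∣p∣+∣q∣ p q)
∣p∪q∣≤∣p∣+∣q∣ (outside ∷ p) (inside ∷ q) =
  ≤-trans (s≤s (∣p∪q∣≤∣p∣+∣q∣ p q)) (≤-reflexive (sym (+-suc ∣ p ∣ ∣ q ∣)))
∣p∪q∣≤∣p∣+∣q∣ (outside ∷ p) (outside ∷ q) = ∣p∪q∣≤∣p∣+∣q∣ p q

InjectionInto : ∀ {n} k → Subset n → Set
InjectionInto {n} k p = Σ (Fin k → Fin n) λ f → Injective _≡_ _≡_ f × (∀ i → f i ∈ p)

k≤∣p∣⇒injectionInto : ∀ (p : Subset n) k → k ≤ ∣ p ∣ → InjectionInto k p
k≤∣p∣⇒injectionInto p zero _ = (λ ()) , (λ {}) , (λ ())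
k≤∣p∣⇒injectionInto (outside ∷ p) (suc k) le with k≤∣p∣⇒injectionInto p (suc k) le
... | f , f-inj , f∈p = suc ∘ f , f-inj ∘ Fin.suc-injective , there ∘ f∈p
k≤∣p∣⇒injectionInto (inside ∷ p) (suc k) (s≤s le) with k≤∣p∣⇒injectionInto p k le
... | f , f-inj , f∈p = g , g-inj , g∈p
  where
  g : Fin (suc k) → Fin _
  g zero = zero
  g (suc i) = suc (f i)
  g-inj : Injective _≡_ _≡_ g
  g-inj {zero} {zero} _ = refl
  g-inj {suc i} {suc j} e = cong suc (f-inj (Fin.suc-injective e))
  g∈p : ∀ i → g i ∈ inside ∷ p
  g∈p zero = here
  g∈p (suc i) = there (f∈p i)

injectionInto⇒k≤∣p∣ : ∀ k (p : Subset n) → InjectionInto k p → k ≤ ∣ p ∣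
injectionInto⇒k≤∣p∣ zero p _ = z≤n
injectionInto⇒k≤∣p∣ (suc k) p (f , f-inj , f∈p) =
  ≤-trans (s≤s (injectionInto⇒k≤∣p∣ k (p - f zero) (f ∘ suc , Fin.suc-injective ∘ f-inj , f∘suc∈p-f₀)))
          (x∈p⇒∣p-x∣<∣p∣ (f∈p zero))
  where
  f∘suc∈p-f₀ : ∀ i → f (suc i) ∈ p - f zero
  f∘suc∈p-f₀ i = x∈p∧x≢y⇒x∈p-y (f∈p (suc i)) (λ e → contradiction (f-inj e) λ ())

injectionInto-surjective : ∀ {k} {p : Subset n} (ι : InjectionInto k p) → ∣ p ∣ ≤ k →
                           ∀ {z} → z ∈ p → ∃ λ i → proj₁ ι i ≡ z
injectionInto-surjective {k = k} {p} (f , f-inj , f∈p) ∣p∣≤k {z} z∈p with Fin.any? (λ i → f i Fin.≟ z)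
... | yes hit = hit
... | no miss = contradiction (≤-trans ∣p∣≤k (injectionInto⇒k≤∣p∣ k (p - z) (f , f-inj , f∈p-z)))
                              (<⇒≱ (x∈p⇒∣p-x∣<∣p∣ z∈p))
  where
  f∈p-z : ∀ i → f i ∈ p - z
  f∈p-z i = x∈p∧x≢y⇒x∈p-y (f∈p i) (λ e → miss (i , e))

-- Menger's theorem for digraphs

data InitLast {A : Set} (P Q : A → Set) : List A → Set where
  end : ∀ {x} → Q x → InitLast P Q [ x ]
  _∷_ : ∀ {x y ys} → P x → InitLast P Q (y ∷ ys) → InitLast P Q (x ∷ y ∷ ys)

module _ {A : Set} {P Q : A → Set} where

  initLast⁻ : ∀ {xs} → InitLast P Q xs → ∃ λ ys → ∃ λ z → xs ≡ ys ∷ʳ z × All P ys × Q z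
  initLast⁻ (end q) = [] , _ , refl , [] , q
  initLast⁻ (_∷_ {x} p ps) with initLast⁻ ps
  ... | ys , z , eq , pys , qz = x ∷ ys , z , cong (x ∷_) eq , p ∷ pys , qz

  initLast-++⁺ : ∀ xs {ys} → All P xs → InitLast P Q ys → InitLast P Q (xs ++ ys)
  initLast-++⁺ [] [] qs = qs
  initLast-++⁺ (x ∷ []) (p ∷ []) (end q) = p ∷ end q
  initLast-++⁺ (x ∷ []) (p ∷ []) (q ∷ qs) = p ∷ q ∷ qs
  initLast-++⁺ (x ∷ x' ∷ xs) (p ∷ ps) qs = p ∷ initLast-++⁺ (x' ∷ xs) ps qs

all-reverse⁺ : ∀ {A : Set} {P : A → Set} {xs} → All P xs → All P (reverse xs)
all-reverse⁺ [] = []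
all-reverse⁺ {xs = x ∷ xs} (p ∷ ps) rewrite unfold-reverse x xs = All.∷ʳ⁺ (all-reverse⁺ ps) p

linked-glue : ∀ {A : Set} {R : A → A → Set} xs {y zs} →
              Linked R (xs ∷ʳ y) → Linked R (y ∷ zs) → Linked R (xs ++ y ∷ zs)
linked-glue [] _ r = r
linked-glue (x ∷ []) (r ∷ [-]) rs = r ∷ rs
linked-glue (x ∷ x' ∷ xs) (r ∷ rs) rs' = r ∷ linked-glue (x' ∷ xs) rs rs'

unique-∷ʳ⁻ : ∀ {A : Set} xs {y : A} → Unique (xs ∷ʳ y) → Unique xs × All (_≢ y) xs
unique-∷ʳ⁻ [] _ = [] , []
unique-∷ʳ⁻ (x ∷ xs) (x∉ ∷ u) with All.∷ʳ⁻ x∉ | unique-∷ʳ⁻ xs u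
... | x∉xs , x≢y | uxs , xs≢y = x∉xs ∷ uxs , x≢y ∷ xs≢y

∈-∷ʳ⁻ : ∀ {A : Set} xs {y v : A} → v ∈ₗ xs ∷ʳ y → v ∈ₗ xs ⊎ v ≡ y
∈-∷ʳ⁻ xs m with ∈-++⁻ xs m
... | inj₁ v∈xs = inj₁ v∈xs
... | inj₂ (here v≡y) = inj₂ v≡y

-- Menger's theorem is proved for arbitrary Boolean relations, since deleting one arc of a graph
-- leaves a non-symmetric relation.
BoolRel : ℕ → Set
BoolRel n = Fin n → Fin n → Bool

Arc : BoolRel n → Fin n → Fin n → Set
Arc E x y = E x y ≡ true

_⊆ᴿ_ : BoolRel n → BoolRel n → Set
E ⊆ᴿ E' = ∀ {u v} → Arc E u v → Arc E' u v

record DPath (E : BoolRel n) (A B : Subset n) (L : List (Fin n)) : Set where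
  constructor mkDPath
  field
    unique : Unique L
    linked : Linked (Arc E) L
    starts : StartsIn A L
    ends   : InitLast (_∉ B) (_∈ B) L

DisjointDPaths : BoolRel n → Subset n → Subset n → ℕ → Set
DisjointDPaths {n} E A B k = Σ (Fin k → List (Fin n)) λ Ps → (∀ i → DPath E A B (Ps i)) ×
  (∀ i j → i ≢ j → ∀ v → v ∈ₗ Ps i → v ∈ₗ Ps j → ⊥)

IsSeparation : BoolRel n → Subset n → Subset n → Set
IsSeparation E X Y =
  (∀ v → v ∈ X ⊎ v ∈ Y) × (∀ u v → u ∈ X → u ∉ Y → v ∈ Y → v ∉ X → ¬ Arc E u v)

SmallSeparation : BoolRel n → Subset n → Subset n → ℕ → Set
SmallSeparation {n} E A B k = Σ (Subset n) λ X → Σ (Subset n) λ Y →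
  IsSeparation E X Y × A ⊆ X × B ⊆ Y × ∣ X ∩ Y ∣ < k

Menger : BoolRel n → Subset n → Subset n → ℕ → Set
Menger E A B k = DisjointDPaths E A B k ⊎ SmallSeparation E A B k

dPath-mono : ∀ {E E' : BoolRel n} {A B L} → E ⊆ᴿ E' → DPath E A B L → DPath E' A B L
dPath-mono E⊆E' (mkDPath u l s e) = mkDPath u (Linked.map E⊆E' l) s e

dPath-ends⇒startsIn-reverse : ∀ {E : BoolRel n} {A B L} → DPath E A B L → StartsIn B (reverse L)
dPath-ends⇒startsIn-reverse p with initLast⁻ (DPath.ends p)
... | ps , b , refl , ps∉B , b∈B rewrite reverse-++ ps [ b ] = b∈B , all-reverse⁺ ps∉B

OnlyIn : Subset n → Subset n → Fin n → Set
OnlyIn X Y v = v ∈ X × v ∉ Y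

NotInBoth : Subset n → Subset n → Fin n → Set
NotInBoth X Y v = v ∈ X → v ∈ Y → ⊥

module _ {E : BoolRel n} {X Y : Subset n} (sep : IsSeparation E X Y) where

  ∉ˡ⇒∈ʳ : ∀ {v} → v ∉ X → v ∈ Y
  ∉ˡ⇒∈ʳ {v} v∉X with proj₁ sep v
  ... | inj₁ v∈X = contradiction v∈X v∉X
  ... | inj₂ v∈Y = v∈Y

  ∉ʳ⇒∈ˡ : ∀ {v} → v ∉ Y → v ∈ X
  ∉ʳ⇒∈ˡ {v} v∉Y with proj₁ sep v
  ... | inj₁ v∈X = v∈X
  ... | inj₂ v∈Y = contradiction v∈Y v∉Y

  arc-from-X∖Y : ∀ {u w} → OnlyIn X Y u → Arc E u w → w ∈ X
  arc-from-X∖Y {u} {w} (u∈X , u∉Y) uw with w ∈? X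
  ... | yes w∈X = w∈X
  ... | no w∉X = ⊥-elim (proj₂ sep u w u∈X u∉Y (∉ˡ⇒∈ʳ w∉X) w∉X uw)

  arc-into-Y∖X : ∀ {u w} → Arc E u w → OnlyIn Y X w → u ∈ Y
  arc-into-Y∖X {u} {w} uw (w∈Y , w∉X) with u ∈? Y
  ... | yes u∈Y = u∈Y
  ... | no u∉Y = ⊥-elim (proj₂ sep u w (∉ʳ⇒∈ˡ u∉Y) u∉Y w∈Y w∉X uw)

  forward : ∀ v ps a → v ∈ X → All (NotInBoth X Y) (v ∷ ps) → Linked (Arc E) (v ∷ ps ∷ʳ a) →
            All (OnlyIn X Y) (v ∷ ps) × a ∈ X
  forward v [] a v∈X (v∉ ∷ []) (e ∷ [-]) = (v∈X , v∉ v∈X) ∷ [] , arc-from-X∖Y (v∈X , v∉ v∈X) e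
  forward v (p ∷ ps) a v∈X (v∉ ∷ ps∉) (e ∷ l) with forward p ps a (arc-from-X∖Y (v∈X , v∉ v∈X) e) ps∉ l
  ... | ps∈ , a∈X = (v∈X , v∉ v∈X) ∷ ps∈ , a∈X

  forward-from : ∀ {A} ps a → A ⊆ X → StartsIn A (ps ∷ʳ a) → All (NotInBoth X Y) ps →
                 Linked (Arc E) (ps ∷ʳ a) → All (OnlyIn X Y) ps × a ∈ X
  forward-from [] a A⊆X (a∈A , _) _ _ = [] , A⊆X a∈A
  forward-from (v ∷ ps) a A⊆X (v∈A , _) = forward v ps a (A⊆X v∈A)

  backward-to : ∀ {P : Fin n → Set} {B} v vs → B ⊆ Y → InitLast P (_∈ B) (v ∷ vs) → All (NotInBoth X Y) vs →
                Linked (Arc E) (v ∷ vs) → All (OnlyIn Y X) vs × v ∈ Y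
  backward-to v [] B⊆Y (end v∈B) [] _ = [] , B⊆Y v∈B
  backward-to v (w ∷ ws) B⊆Y (_ ∷ ends) (w∉ ∷ ws∉) (e ∷ l) with backward-to w ws B⊆Y ends ws∉ l
  ... | ws∈ , w∈Y = w∈Y∖X ∷ ws∈ , arc-into-Y∖X e w∈Y∖X
    where
    w∈Y∖X : OnlyIn Y X w
    w∈Y∖X = w∈Y , λ w∈X → w∉ w∈X w∈Y

glue : ∀ {E : BoolRel n} {A B X Y : Subset n} → A ⊆ X → B ⊆ Y → ∀ ps a R →
  Unique (ps ∷ʳ a) → Linked (Arc E) (ps ∷ʳ a) → StartsIn A (ps ∷ʳ a) → All (OnlyIn X Y) ps →
  Unique (a ∷ R) → Linked (Arc E) (a ∷ R) → InitLast (_∉ B) (_∈ B) (a ∷ R) → All (OnlyIn Y X) R →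
  DPath E A B (ps ++ a ∷ R)
glue {E = E} {A} {B} {X} {Y} A⊆X B⊆Y ps a R uL lL sL psXY uR lR eR RYX =
  mkDPath (AllPairs.++⁺ ups uR (apart ps ps≢a psXY)) (linked-glue ps lL lR) (starts ps sL)
          (initLast-++⁺ ps (All.map (λ v∈ v∈B → proj₂ v∈ (B⊆Y v∈B)) psXY) eR)
  where
  ups : Unique ps
  ups = proj₁ (unique-∷ʳ⁻ ps uL)
  ps≢a : All (_≢ a) ps
  ps≢a = proj₂ (unique-∷ʳ⁻ ps uL)
  apart : ∀ qs → All (_≢ a) qs → All (OnlyIn X Y) qs → All (λ p → All (p ≢_) (a ∷ R)) qs
  apart [] [] [] = []
  apart (q ∷ qs) (q≢a ∷ qs≢a) ((_ , q∉Y) ∷ qsXY) =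
    (q≢a ∷ All.map (λ r∈ q≡r → q∉Y (subst (_∈ Y) (sym q≡r) (proj₁ r∈))) RYX) ∷ apart qs qs≢a qsXY
  R∉A : All (_∉ A) R
  R∉A = All.map (λ r∈ r∈A → proj₂ r∈ (A⊆X r∈A)) RYX
  starts : ∀ qs → StartsIn A (qs ∷ʳ a) → StartsIn A (qs ++ a ∷ R)
  starts [] (a∈A , _) = a∈A , R∉A
  starts (q ∷ qs) (q∈A , rest) with All.∷ʳ⁻ rest
  ... | qs∉A , a∉A = q∈A , All.++⁺ qs∉A (a∉A ∷ R∉A)

removeArc : BoolRel n → Fin n → Fin n → BoolRel n
removeArc E x y u v with u ≟ x | v ≟ y
... | yes _ | yes _ = false
... | _     | _     = E u v

removeArc-⊆ : ∀ (E : BoolRel n) x y → removeArc E x y ⊆ᴿ E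
removeArc-⊆ E x y {u} {v} e with u ≟ x | v ≟ y
... | yes _ | no _  = e
... | no _  | yes _ = e
... | no _  | no _  = e

removeArc-removed : ∀ (E : BoolRel n) x y → removeArc E x y x y ≡ false
removeArc-removed E x y with x ≟ x | y ≟ y
... | yes _ | yes _ = refl
... | no x≢x | _    = contradiction refl x≢x
... | yes _ | no y≢y = contradiction refl y≢y

arc⇒removed⊎arc : ∀ (E : BoolRel n) x y {u v} → Arc E u v → (u ≡ x × v ≡ y) ⊎ Arc (removeArc E x y) u v
arc⇒removed⊎arc E x y {u} {v} e with u ≟ x | v ≟ y
... | yes u≡x | yes v≡y = inj₁ (u≡x , v≡y)
... | yes _   | no _    = inj₂ e
... | no _    | yes _   = inj₂ e
... | no _    | no _    = inj₂ e

∑ : ∀ {m} → (Fin m → ℕ) → ℕ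
∑ {zero} f = 0
∑ {suc m} f = f zero + ∑ (λ i → f (suc i))

∑-mono-≤ : ∀ {m} {f g : Fin m → ℕ} → (∀ i → f i ≤ g i) → ∑ f ≤ ∑ g
∑-mono-≤ {zero} f≤g = z≤n
∑-mono-≤ {suc m} f≤g = +-mono-≤ (f≤g zero) (∑-mono-≤ (λ i → f≤g (suc i)))

∑-mono-< : ∀ {m} {f g : Fin m → ℕ} → (∀ i → f i ≤ g i) → ∀ j → f j < g j → ∑ f < ∑ g
∑-mono-< f≤g zero fj<gj = +-mono-<-≤ fj<gj (∑-mono-≤ (λ i → f≤g (suc i)))
∑-mono-< f≤g (suc j) fj<gj = +-mono-≤-< (f≤g zero) (∑-mono-< (λ i → f≤g (suc i)) j fj<gj)

arcCount : BoolRel n → ℕ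
arcCount E = ∑ λ u → ∑ λ v → if E u v then 1 else 0

arcCount-< : ∀ {E' E : BoolRel n} {x y} → E' ⊆ᴿ E → Arc E x y → E' x y ≡ false → arcCount E' < arcCount E
arcCount-< {E' = E'} {E} {x} {y} E'⊆E exy e'xy =
  ∑-mono-< (λ u → ∑-mono-≤ (λ v → indicator-mono u v)) x
           (∑-mono-< (indicator-mono x) y (subst₂ (λ a b → (if a then 1 else 0) < (if b then 1 else 0))
                                                    (sym e'xy) (sym exy) ≤-refl))
  where
  indicator-mono : ∀ u v → (if E' u v then 1 else 0) ≤ (if E u v then 1 else 0)
  indicator-mono u v with E' u v in e'
  ... | false = z≤n
  ... | true rewrite E'⊆E e' = ≤-refl

module Crossing (E : BoolRel n) {x y : Fin n} (xy : Arc E x y) {X Y : Subset n}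
                (sep : IsSeparation (removeArc E x y) X Y)
                (x∈X : x ∈ X) (x∉Y : x ∉ Y) (y∈Y : y ∈ Y) (y∉X : y ∉ X) where

  E⁻ : BoolRel n
  E⁻ = removeArc E x y

  Sx Sy : Subset n
  Sx = X ∩ Y ∪ ⁅ x ⁆
  Sy = X ∩ Y ∪ ⁅ y ⁆

  ∩⊆Sx : ∀ {w} → w ∈ X → w ∈ Y → w ∈ Sx
  ∩⊆Sx w∈X w∈Y = x∈p∪q⁺ (inj₁ (x∈p∩q⁺ (w∈X , w∈Y)))

  ∩⊆Sy : ∀ {w} → w ∈ X → w ∈ Y → w ∈ Sy
  ∩⊆Sy w∈X w∈Y = x∈p∪q⁺ (inj₁ (x∈p∩q⁺ (w∈X , w∈Y)))

  x∈Sx : x ∈ Sx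
  x∈Sx = x∈p∪q⁺ (inj₂ (x∈⁅x⁆ x))

  y∈Sy : y ∈ Sy
  y∈Sy = x∈p∪q⁺ (inj₂ (x∈⁅x⁆ y))

  ∈S⁻ : ∀ {w z} → w ∈ X ∩ Y ∪ ⁅ z ⁆ → (w ∈ X × w ∈ Y) ⊎ w ≡ z
  ∈S⁻ {z = z} w∈S with x∈p∪q⁻ (X ∩ Y) ⁅ z ⁆ w∈S
  ... | inj₁ w∈X∩Y = inj₁ (x∈p∩q⁻ X Y w∈X∩Y)
  ... | inj₂ w∈⁅z⁆ = inj₂ (x∈⁅y⁆⇒x≡y z w∈⁅z⁆)

  ∣Sy∣≤1+∣X∩Y∣ : ∣ Sy ∣ ≤ suc ∣ X ∩ Y ∣
  ∣Sy∣≤1+∣X∩Y∣ = ≤-trans (∣p∪q∣≤∣p∣+∣q∣ (X ∩ Y) ⁅ y ⁆)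
                         (≤-reflexive (trans (cong (∣ X ∩ Y ∣ +_) (∣⁅x⁆∣≡1 y)) (+-comm ∣ X ∩ Y ∣ 1)))

  -- Matches the end of each A → Sx path with the start of an Sy → B path: x with y (joined by
  -- the arc xy), every vertex of X ∩ Y with itself.
  hop : Fin n → Fin n
  hop a with a ≟ x
  ... | yes _ = y
  ... | no _  = a

  hop-cases : ∀ a → (a ≡ x × hop a ≡ y) ⊎ (a ≢ x × hop a ≡ a)
  hop-cases a with a ≟ x
  ... | yes a≡x = inj₁ (a≡x , refl)
  ... | no a≢x  = inj₂ (a≢x , refl)

  hop-∈Sy : ∀ {a} → a ∈ Sx → hop a ∈ Sy
  hop-∈Sy {a} a∈Sx with hop-cases a | ∈S⁻ a∈Sx
  ... | inj₁ (_ , hop≡y) | _ = subst (_∈ Sy) (sym hop≡y) y∈Sy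
  ... | inj₂ (_ , hop≡a) | inj₁ (a∈X , a∈Y) = subst (_∈ Sy) (sym hop≡a) (∩⊆Sy a∈X a∈Y)
  ... | inj₂ (a≢x , _) | inj₂ a≡x = contradiction a≡x a≢x

  ≡hop⇒crosses⊎≡ : ∀ {a b} → b ≡ hop a → (a ≡ x × b ≡ y) ⊎ b ≡ a
  ≡hop⇒crosses⊎≡ {a} b≡hop with hop-cases a
  ... | inj₁ (a≡x , hop≡y) = inj₁ (a≡x , trans b≡hop hop≡y)
  ... | inj₂ (_ , hop≡a) = inj₂ (trans b≡hop hop≡a)

  hop-fixes-X : ∀ {a b} → b ∈ X → b ≡ hop a → b ≡ a
  hop-fixes-X {a} b∈X b≡hop with hop-cases a
  ... | inj₁ (_ , hop≡y) = contradiction (subst (_∈ X) (trans b≡hop hop≡y) b∈X) y∉X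
  ... | inj₂ (_ , hop≡a) = trans b≡hop hop≡a

  hop-injective-on-X : ∀ {a a'} → a ∈ X → a' ∈ X → hop a ≡ hop a' → a ≡ a'
  hop-injective-on-X {a} {a'} a∈X a'∈X eq with hop-cases a | hop-cases a'
  ... | inj₁ (a≡x , _) | inj₁ (a'≡x , _) = trans a≡x (sym a'≡x)
  ... | inj₂ (_ , hop≡a) | _ = hop-fixes-X a∈X (trans (sym hop≡a) eq)
  ... | inj₁ _ | inj₂ (_ , hop≡a') = sym (hop-fixes-X a'∈X (trans (sym hop≡a') (sym eq)))

  record LeftPart (A : Subset n) (L : List (Fin n)) : Set where
    field
      ps     : List (Fin n)
      a      : Fin n
      L≡     : L ≡ ps ∷ʳ a
      a∈Sx   : a ∈ Sx
      a∈X    : a ∈ X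
      ps∈X∖Y : All (OnlyIn X Y) ps
      path   : DPath E⁻ A Sx (ps ∷ʳ a)

  record RightPart (B : Subset n) (L : List (Fin n)) : Set where
    field
      q      : Fin n
      qs     : List (Fin n)
      L≡     : L ≡ q ∷ qs
      q∈Sy   : q ∈ Sy
      q∈Y    : q ∈ Y
      qs∈Y∖X : All (OnlyIn Y X) qs
      path   : DPath E⁻ Sy B (q ∷ qs)

  module _ {A L} (lp : LeftPart A L) where
    open LeftPart lp

    leftPart-a∈ : a ∈ₗ L
    leftPart-a∈ rewrite L≡ = ∈-++⁺ʳ ps (here refl)

    leftPart-∈⁻ : ∀ {v} → v ∈ₗ L → OnlyIn X Y v ⊎ v ≡ a
    leftPart-∈⁻ v∈L rewrite L≡ with ∈-∷ʳ⁻ ps v∈L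
    ... | inj₁ v∈ps = inj₁ (All.lookup ps∈X∖Y v∈ps)
    ... | inj₂ v≡a = inj₂ v≡a

  module _ {B L} (rp : RightPart B L) where
    open RightPart rp

    rightPart-q∈ : q ∈ₗ L
    rightPart-q∈ rewrite L≡ = here refl

    rightPart-∈⁻ : ∀ {v} → v ∈ₗ L → v ≡ q ⊎ OnlyIn Y X v
    rightPart-∈⁻ v∈L rewrite L≡ with v∈L
    ... | here v≡q = inj₁ v≡q
    ... | there v∈qs = inj₂ (All.lookup qs∈Y∖X v∈qs)

  leftPart : ∀ {A L} → A ⊆ X → DPath E⁻ A Sx L → LeftPart A L
  leftPart A⊆X P@(mkDPath _ linked starts ends) with initLast⁻ ends
  ... | ps , a , refl , ps∉Sx , a∈Sx
    with forward-from sep ps a A⊆X starts (All.map (λ w∉ w∈X w∈Y → w∉ (∩⊆Sx w∈X w∈Y)) ps∉Sx) linked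
  ... | ps∈X∖Y , a∈X =
    record { ps = ps ; a = a ; L≡ = refl ; a∈Sx = a∈Sx ; a∈X = a∈X ; ps∈X∖Y = ps∈X∖Y ; path = P }

  rightPart : ∀ {B L} → B ⊆ Y → DPath E⁻ Sy B L → RightPart B L
  rightPart {L = q ∷ qs} B⊆Y P@(mkDPath _ linked (q∈Sy , qs∉Sy) ends)
    with backward-to sep q qs B⊆Y ends (All.map (λ w∉ w∈X w∈Y → w∉ (∩⊆Sy w∈X w∈Y)) qs∉Sy) linked
  ... | qs∈Y∖X , q∈Y =
    record { q = q ; qs = qs ; L≡ = refl ; q∈Sy = q∈Sy ; q∈Y = q∈Y ; qs∈Y∖X = qs∈Y∖X ; path = P }

  join : ∀ {A B L L'} → A ⊆ X → B ⊆ Y → (lp : LeftPart A L) (rp : RightPart B L') →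
         (LeftPart.a lp ≡ x × RightPart.q rp ≡ y) ⊎ RightPart.q rp ≡ LeftPart.a lp →
         ∃ λ J → DPath E A B J × (∀ {v} → v ∈ₗ J → v ∈ₗ L ⊎ v ∈ₗ L')
  join A⊆X B⊆Y record { ps = ps ; L≡ = refl ; ps∈X∖Y = ps∈X∖Y ; path = mkDPath uL lL sL _ }
               record { qs = qs ; L≡ = refl ; qs∈Y∖X = qs∈Y∖X ; path = mkDPath uR lR _ eR }
               (inj₁ (refl , refl)) =
    ps ++ x ∷ y ∷ qs ,
    glue A⊆X B⊆Y ps x (y ∷ qs) uL (Linked.map (removeArc-⊆ E x y) lL) sL ps∈X∖Y
         (All.map (λ w∈Y x≡w → x∉Y (subst (_∈ Y) (sym x≡w) w∈Y)) (y∈Y ∷ All.map proj₁ qs∈Y∖X) ∷ uR)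
         (xy ∷ Linked.map (removeArc-⊆ E x y) lR) ((λ x∈B → x∉Y (B⊆Y x∈B)) ∷ eR)
         ((y∈Y , y∉X) ∷ qs∈Y∖X) ,
    split
    where
    split : ∀ {v} → v ∈ₗ ps ++ x ∷ y ∷ qs → v ∈ₗ ps ∷ʳ x ⊎ v ∈ₗ y ∷ qs
    split m with ∈-++⁻ ps m
    ... | inj₁ v∈ps = inj₁ (∈-++⁺ˡ v∈ps)
    ... | inj₂ (here v≡x) = inj₁ (∈-++⁺ʳ ps (here v≡x))
    ... | inj₂ (there v∈) = inj₂ v∈
  join A⊆X B⊆Y record { ps = ps ; L≡ = refl ; ps∈X∖Y = ps∈X∖Y ; path = mkDPath uL lL sL _ }
               record { q = q ; qs = qs ; L≡ = refl ; qs∈Y∖X = qs∈Y∖X ; path = mkDPath uR lR _ eR }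
               (inj₂ refl) =
    ps ++ q ∷ qs ,
    glue A⊆X B⊆Y ps q qs uL (Linked.map (removeArc-⊆ E x y) lL) sL ps∈X∖Y
         uR (Linked.map (removeArc-⊆ E x y) lR) eR qs∈Y∖X ,
    split
    where
    split : ∀ {v} → v ∈ₗ ps ++ q ∷ qs → v ∈ₗ ps ∷ʳ q ⊎ v ∈ₗ q ∷ qs
    split m with ∈-++⁻ ps m
    ... | inj₁ v∈ps = inj₁ (∈-++⁺ˡ v∈ps)
    ... | inj₂ v∈ = inj₂ v∈

  combine : ∀ {A B k} → A ⊆ X → B ⊆ Y → ∣ Sy ∣ ≤ k →
            DisjointDPaths E⁻ A Sx k → DisjointDPaths E⁻ Sy B k → DisjointDPaths E A B k
  combine {A} {B} {k} A⊆X B⊆Y ∣Sy∣≤k (Ps , Ps-paths , Ps-disj) (Qs , Qs-paths , Qs-disj) =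
    Js , (λ i → proj₁ (proj₂ (joined i))) , Js-disj
    where
    lp : ∀ i → LeftPart A (Ps i)
    lp i = leftPart A⊆X (Ps-paths i)
    rp : ∀ j → RightPart B (Qs j)
    rp j = rightPart B⊆Y (Qs-paths j)
    a q : Fin k → Fin n
    a i = LeftPart.a (lp i)
    q j = RightPart.q (rp j)

    a-distinct : ∀ {i i'} → i ≢ i' → a i ≢ a i'
    a-distinct i≢i' a≡a' =
      Ps-disj _ _ i≢i' _ (leftPart-a∈ (lp _)) (subst (_∈ₗ Ps _) (sym a≡a') (leftPart-a∈ (lp _)))

    q-injective : Injective _≡_ _≡_ q
    q-injective {j} {j'} q≡q' with j ≟ j'
    ... | yes j≡j' = j≡j'
    ... | no j≢j' =
      ⊥-elim (Qs-disj j j' j≢j' (q j) (rightPart-q∈ (rp j)) (subst (_∈ₗ Qs j') (sym q≡q') (rightPart-q∈ (rp j'))))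

    partner : ∀ i → ∃ λ j → q j ≡ hop (a i)
    partner i = injectionInto-surjective (q , q-injective , λ j → RightPart.q∈Sy (rp j)) ∣Sy∣≤k
                                         (hop-∈Sy (LeftPart.a∈Sx (lp i)))

    σ : Fin k → Fin k
    σ i = proj₁ (partner i)

    link : ∀ i → (a i ≡ x × q (σ i) ≡ y) ⊎ q (σ i) ≡ a i
    link i = ≡hop⇒crosses⊎≡ (proj₂ (partner i))

    joined : ∀ i → ∃ λ J → DPath E A B J × (∀ {v} → v ∈ₗ J → v ∈ₗ Ps i ⊎ v ∈ₗ Qs (σ i))
    joined i = join A⊆X B⊆Y (lp i) (rp (σ i)) (link i)

    Js : Fin k → List (Fin n)
    Js i = proj₁ (joined i)

    left-right-disjoint : ∀ {i i'} → i ≢ i' → ∀ {v} → v ∈ₗ Ps i → v ∈ₗ Qs (σ i') → ⊥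
    left-right-disjoint {i} {i'} i≢i' v∈P v∈Q
      with leftPart-∈⁻ (lp i) v∈P | rightPart-∈⁻ (rp (σ i')) v∈Q
    ... | inj₁ (_ , v∉Y) | inj₁ refl = v∉Y (RightPart.q∈Y (rp (σ i')))
    ... | inj₁ (_ , v∉Y) | inj₂ (v∈Y , _) = v∉Y v∈Y
    ... | inj₂ refl | inj₂ (_ , v∉X) = v∉X (LeftPart.a∈X (lp i))
    ... | inj₂ v≡a | inj₁ v≡q =
      a-distinct i≢i' (hop-fixes-X (LeftPart.a∈X (lp i)) (trans (sym v≡a) (trans v≡q (proj₂ (partner i')))))

    Js-disj : ∀ i i' → i ≢ i' → ∀ v → v ∈ₗ Js i → v ∈ₗ Js i' → ⊥
    Js-disj i i' i≢i' v v∈J v∈J' with proj₂ (proj₂ (joined i)) v∈J | proj₂ (proj₂ (joined i')) v∈J'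
    ... | inj₁ v∈P | inj₁ v∈P' = Ps-disj i i' i≢i' v v∈P v∈P'
    ... | inj₁ v∈P | inj₂ v∈Q' = left-right-disjoint i≢i' v∈P v∈Q'
    ... | inj₂ v∈Q | inj₁ v∈P' = left-right-disjoint (i≢i' ∘ sym) v∈P' v∈Q
    ... | inj₂ v∈Q | inj₂ v∈Q' with σ i ≟ σ i'
    ...   | no σ≢σ' = Qs-disj (σ i) (σ i') σ≢σ' v v∈Q v∈Q'
    ...   | yes σ≡σ' = a-distinct i≢i' (hop-injective-on-X (LeftPart.a∈X (lp i)) (LeftPart.a∈X (lp i'))
                         (trans (sym (proj₂ (partner i))) (trans (cong q σ≡σ') (proj₂ (partner i')))))

  lift-left : ∀ {A B k} → A ⊆ X → B ⊆ Y → SmallSeparation E⁻ A Sx k → SmallSeparation E A B k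
  lift-left {A} {B} A⊆X B⊆Y (X' , Y' , sep' , A⊆X' , Sx⊆Y' , small) =
    X' ∩ X , Y' ∪ Y , (cover , no-arc) , (λ v∈A → x∈p∩q⁺ (A⊆X' v∈A , A⊆X v∈A)) ,
    (λ v∈B → x∈p∪q⁺ (inj₂ (B⊆Y v∈B))) , ≤-<-trans (p⊆q⇒∣p∣≤∣q∣ separator⊆) small
    where
    cover : ∀ v → v ∈ X' ∩ X ⊎ v ∈ Y' ∪ Y
    cover v with proj₁ sep v | proj₁ sep' v
    ... | inj₂ v∈Y | _ = inj₂ (x∈p∪q⁺ (inj₂ v∈Y))
    ... | inj₁ v∈X | inj₁ v∈X' = inj₁ (x∈p∩q⁺ (v∈X' , v∈X))
    ... | inj₁ _ | inj₂ v∈Y' = inj₂ (x∈p∪q⁺ (inj₁ v∈Y'))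
    no-arc : ∀ u v → u ∈ X' ∩ X → u ∉ Y' ∪ Y → v ∈ Y' ∪ Y → v ∉ X' ∩ X → ¬ Arc E u v
    no-arc u v u∈ u∉ _ v∉ uv with x∈p∩q⁻ X' X u∈ | arc⇒removed⊎arc E x y uv
    ... | _ | inj₁ (refl , _) = u∉ (x∈p∪q⁺ (inj₁ (Sx⊆Y' x∈Sx)))
    ... | u∈X' , u∈X | inj₂ uv⁻ with v ∈? X
    ...   | no v∉X = proj₂ sep u v u∈X (u∉ ∘ x∈p∪q⁺ ∘ inj₂) (∉ˡ⇒∈ʳ sep v∉X) v∉X uv⁻
    ...   | yes v∈X = proj₂ sep' u v u∈X' (u∉ ∘ x∈p∪q⁺ ∘ inj₁) (∉ˡ⇒∈ʳ sep' v∉X') v∉X' uv⁻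
      where
      v∉X' : v ∉ X'
      v∉X' v∈X' = v∉ (x∈p∩q⁺ (v∈X' , v∈X))
    separator⊆ : (X' ∩ X) ∩ (Y' ∪ Y) ⊆ X' ∩ Y'
    separator⊆ w∈ with x∈p∩q⁻ (X' ∩ X) (Y' ∪ Y) w∈
    ... | w∈X'∩X , w∈Y'∪Y with x∈p∩q⁻ X' X w∈X'∩X | x∈p∪q⁻ Y' Y w∈Y'∪Y
    ...   | w∈X' , _ | inj₁ w∈Y' = x∈p∩q⁺ (w∈X' , w∈Y')
    ...   | w∈X' , w∈X | inj₂ w∈Y = x∈p∩q⁺ (w∈X' , Sx⊆Y' (∩⊆Sx w∈X w∈Y))

  lift-right : ∀ {A B k} → A ⊆ X → B ⊆ Y → SmallSeparation E⁻ Sy B k → SmallSeparation E A B k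
  lift-right {A} {B} A⊆X B⊆Y (X' , Y' , sep' , Sy⊆X' , B⊆Y' , small) =
    X' ∪ X , Y' ∩ Y , (cover , no-arc) , (λ v∈A → x∈p∪q⁺ (inj₂ (A⊆X v∈A))) ,
    (λ v∈B → x∈p∩q⁺ (B⊆Y' v∈B , B⊆Y v∈B)) , ≤-<-trans (p⊆q⇒∣p∣≤∣q∣ separator⊆) small
    where
    cover : ∀ v → v ∈ X' ∪ X ⊎ v ∈ Y' ∩ Y
    cover v with proj₁ sep v | proj₁ sep' v
    ... | inj₁ v∈X | _ = inj₁ (x∈p∪q⁺ (inj₂ v∈X))
    ... | inj₂ _ | inj₁ v∈X' = inj₁ (x∈p∪q⁺ (inj₁ v∈X'))
    ... | inj₂ v∈Y | inj₂ v∈Y' = inj₂ (x∈p∩q⁺ (v∈Y' , v∈Y))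
    no-arc : ∀ u v → u ∈ X' ∪ X → u ∉ Y' ∩ Y → v ∈ Y' ∩ Y → v ∉ X' ∪ X → ¬ Arc E u v
    no-arc u v _ u∉ v∈ v∉ uv with x∈p∩q⁻ Y' Y v∈ | arc⇒removed⊎arc E x y uv
    ... | _ | inj₁ (_ , refl) = v∉ (x∈p∪q⁺ (inj₁ (Sy⊆X' y∈Sy)))
    ... | v∈Y' , v∈Y | inj₂ uv⁻ with u ∈? Y
    ...   | no u∉Y = proj₂ sep u v (∉ʳ⇒∈ˡ sep u∉Y) u∉Y v∈Y (v∉ ∘ x∈p∪q⁺ ∘ inj₂) uv⁻
    ...   | yes u∈Y = proj₂ sep' u v (∉ʳ⇒∈ˡ sep' u∉Y') u∉Y' v∈Y' (v∉ ∘ x∈p∪q⁺ ∘ inj₁) uv⁻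
      where
      u∉Y' : u ∉ Y'
      u∉Y' u∈Y' = u∉ (x∈p∩q⁺ (u∈Y' , u∈Y))
    separator⊆ : (X' ∪ X) ∩ (Y' ∩ Y) ⊆ X' ∩ Y'
    separator⊆ w∈ with x∈p∩q⁻ (X' ∪ X) (Y' ∩ Y) w∈
    ... | w∈X'∪X , w∈Y'∩Y with x∈p∪q⁻ X' X w∈X'∪X | x∈p∩q⁻ Y' Y w∈Y'∩Y
    ...   | inj₁ w∈X' | w∈Y' , _ = x∈p∩q⁺ (w∈X' , w∈Y')
    ...   | inj₂ w∈X | w∈Y' , w∈Y = x∈p∩q⁺ (Sy⊆X' (∩⊆Sy w∈X w∈Y) , w∈Y')

  crossing-step : ∀ {A B k} → A ⊆ X → B ⊆ Y → ∣ X ∩ Y ∣ < k →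
                  Menger E⁻ A Sx k → Menger E⁻ Sy B k → Menger E A B k
  crossing-step A⊆X B⊆Y _ (inj₂ small) _ = inj₂ (lift-left A⊆X B⊆Y small)
  crossing-step A⊆X B⊆Y _ (inj₁ _) (inj₂ small) = inj₂ (lift-right A⊆X B⊆Y small)
  crossing-step A⊆X B⊆Y ∣X∩Y∣<k (inj₁ Ps) (inj₁ Qs) =
    inj₁ (combine A⊆X B⊆Y (≤-trans ∣Sy∣≤1+∣X∩Y∣ ∣X∩Y∣<k) Ps Qs)

trivial-paths : ∀ {E : BoolRel n} {A B k} → k ≤ ∣ A ∩ B ∣ → DisjointDPaths E A B k
trivial-paths {A = A} {B} {k} k≤∣A∩B∣ with k≤∣p∣⇒injectionInto (A ∩ B) k k≤∣A∩B∣
... | f , f-inj , f∈A∩B =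
  (λ i → [ f i ]) , single , λ { i j i≢j _ (here refl) (here fi≡fj) → i≢j (f-inj fi≡fj) }
  where
  single : ∀ i → DPath _ A B [ f i ]
  single i with x∈p∩q⁻ A B (f∈A∩B i)
  ... | fi∈A , fi∈B = mkDPath ([] ∷ []) [-] (fi∈A , []) (end fi∈B)

arcless-separation : ∀ {E : BoolRel n} {A B} → (∀ u v → ¬ Arc E u v) →
                     SmallSeparation E A B (suc ∣ A ∩ B ∣)
arcless-separation {A = A} {B} no-arcs =
  A , B ∪ ∁ A , (cover , λ u v _ _ _ _ → no-arcs u v) , (λ v∈A → v∈A) , (λ v∈B → x∈p∪q⁺ (inj₁ v∈B)) ,
  s≤s (p⊆q⇒∣p∣≤∣q∣ separator⊆)
  where
  cover : ∀ v → v ∈ A ⊎ v ∈ B ∪ ∁ A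
  cover v with v ∈? A
  ... | yes v∈A = inj₁ v∈A
  ... | no v∉A = inj₂ (x∈p∪q⁺ (inj₂ (x∉p⇒x∈∁p v∉A)))
  separator⊆ : A ∩ (B ∪ ∁ A) ⊆ A ∩ B
  separator⊆ w∈ with x∈p∩q⁻ A (B ∪ ∁ A) w∈
  ... | w∈A , w∈B∪∁A with x∈p∪q⁻ B (∁ A) w∈B∪∁A
  ...   | inj₁ w∈B = x∈p∩q⁺ (w∈A , w∈B)
  ...   | inj₂ w∈∁A = contradiction w∈A (x∈∁p⇒x∉p w∈∁A)

separation-of-removeArc : ∀ {E : BoolRel n} {x y X Y} → IsSeparation (removeArc E x y) X Y →
                          ¬ (x ∈ X × x ∉ Y × y ∈ Y × y ∉ X) → IsSeparation E X Y
separation-of-removeArc {E = E} {x} {y} (cover , no-arc) uncrossed = cover , no-arc'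
  where
  no-arc' : ∀ u v → u ∈ _ → u ∉ _ → v ∈ _ → v ∉ _ → ¬ Arc E u v
  no-arc' u v u∈X u∉Y v∈Y v∉X uv with arc⇒removed⊎arc E x y uv
  ... | inj₁ (refl , refl) = uncrossed (u∈X , u∉Y , v∈Y , v∉X)
  ... | inj₂ uv⁻ = no-arc u v u∈X u∉Y v∈Y v∉X uv⁻

menger-acc : ∀ (E : BoolRel n) → Acc _<_ (arcCount E) → ∀ A B k → Menger E A B k
menger-acc E (acc rec) A B k with Fin.any? (λ u → Fin.any? (λ v → E u v Bool.≟ Bool.true))
... | no no-arcs with ∣ A ∩ B ∣ <? k
...   | yes ∣A∩B∣<k = inj₂ (smaller (arcless-separation (λ u v uv → no-arcs (u , v , uv))))
  where
  smaller : SmallSeparation E A B (suc ∣ A ∩ B ∣) → SmallSeparation E A B k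
  smaller (X , Y , sep , A⊆X , B⊆Y , small) = X , Y , sep , A⊆X , B⊆Y , <-≤-trans small ∣A∩B∣<k
...   | no ∣A∩B∣≮k = inj₁ (trivial-paths (≮⇒≥ ∣A∩B∣≮k))
menger-acc E (acc rec) A B k | yes (x , y , xy) = extend (IH A B k)
  where
  IH : ∀ A B k → Menger (removeArc E x y) A B k
  IH = menger-acc (removeArc E x y)
         (rec (arcCount-< {E' = removeArc E x y} (removeArc-⊆ E x y) xy (removeArc-removed E x y)))
  extend : Menger (removeArc E x y) A B k → Menger E A B k
  extend (inj₁ (Ps , paths , disjoint)) = inj₁ (Ps , dPath-mono (removeArc-⊆ E x y) ∘ paths , disjoint)
  extend (inj₂ (X , Y , sep , A⊆X , B⊆Y , small))
    with x ∈? X ×-dec ¬? (x ∈? Y) ×-dec y ∈? Y ×-dec ¬? (y ∈? X)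
  ... | no uncrossed = inj₂ (X , Y , separation-of-removeArc sep uncrossed , A⊆X , B⊆Y , small)
  ... | yes (x∈X , x∉Y , y∈Y , y∉X) = crossing-step A⊆X B⊆Y small (IH A Sx k) (IH Sy B k)
    where open Crossing E xy sep x∈X x∉Y y∈Y y∉X

menger : ∀ (E : BoolRel n) A B k → Menger E A B k
menger E = menger-acc E (<-wellFounded (arcCount E))

-- Lean tree-decompositions

dPaths⇒hasDisjointPaths : ∀ (G : Graph n) {m Z₁ Z₂} →
                          DisjointDPaths (Graph.adj G) Z₁ Z₂ m → HasDisjointPaths G m Z₁ Z₂
dPaths⇒hasDisjointPaths G {m} {Z₁} {Z₂} (Ps , paths , disjoint) = Vec.tabulate Ps , isABPath , pairwise
  where
  isABPath : ∀ i → IsABPath G Z₁ Z₂ (Vec.lookup (Vec.tabulate Ps) i)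
  isABPath i rewrite Vec.lookup∘tabulate Ps i =
    (DPath.unique (paths i) , DPath.linked (paths i)) , DPath.starts (paths i) , dPath-ends⇒startsIn-reverse (paths i)
  pairwise : ∀ i j → i ≢ j → Disjoint (Vec.lookup (Vec.tabulate Ps) i) (Vec.lookup (Vec.tabulate Ps) j)
  pairwise i j i≢j rewrite Vec.lookup∘tabulate Ps i | Vec.lookup∘tabulate Ps j =
    All.tabulate λ v∈Pi → All.tabulate λ w∈Pj v≡w →
      disjoint i j i≢j _ v∈Pi (subst (_∈ₗ Ps j) (sym v≡w) w∈Pj)

cover⇒∪≡⊤ : ∀ (X Y : Subset n) → (∀ v → v ∈ X ⊎ v ∈ Y) → X ∪ Y ≡ ⊤
cover⇒∪≡⊤ X Y cover = ⊆-antisym ⊆⊤ (λ {v} _ → x∈p∪q⁺ (cover v))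

isSeparation⇒isSep : ∀ (G : Graph n) {X Y} → IsSeparation (Graph.adj G) X Y → IsSep G (X , Y)
isSeparation⇒isSep G {X} {Y} (cover , no-arc) = cover⇒∪≡⊤ X Y cover , no-arc

module _ (G : Graph n) where

  isSep? : ∀ s → Dec (IsSep G s)
  isSep? (X , Y) = Vec.≡-dec Bool._≟_ (X ∪ Y) ⊤ ×-dec
    Fin.all? λ u → Fin.all? λ v →
      u ∈? X →-dec ¬? (u ∈? Y) →-dec v ∈? Y →-dec ¬? (v ∈? X) →-dec ¬? (Graph.adj G u v Bool.≟ true)

  _≤ˢ?_ : ∀ (s s' : Sepn n) → Dec (s ≤ˢ s')
  (A , B) ≤ˢ? (C , D) = A ⊆? C ×-dec D ⊆? B

  Between : Sepn n → Sepn n → Sepn n → Set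
  Between s₁ s₂ s = IsSep G s × s₁ ≤ˢ s × s ≤ˢ s₂

  between? : ∀ s₁ s₂ s → Dec (Between s₁ s₂ s)
  between? s₁ s₂ s = isSep? s ×-dec s₁ ≤ˢ? s ×-dec s ≤ˢ? s₂

  lambda-exists-acc : ∀ {s₁ s₂} s → Acc _<_ (ord s) → Between s₁ s₂ s → ∃ (IsLambda G s₁ s₂)
  lambda-exists-acc {s₁} {s₂} s (acc rec) s-between@(s-sep , s₁≤s , s≤s₂)
    with anySubset? (λ X → anySubset? (λ Y → between? s₁ s₂ (X , Y) ×-dec ord (X , Y) <? ord s))
  ... | yes (X , Y , s'-between , smaller) = lambda-exists-acc (X , Y) (rec smaller) s'-between
  ... | no none = ord s , (s , s-sep , s₁≤s , s≤s₂ , refl) , minimal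
    where
    minimal : ∀ s' → IsSep G s' → s₁ ≤ˢ s' → s' ≤ˢ s₂ → ord s ≤ ord s'
    minimal (X , Y) s'-sep s₁≤s' s'≤s₂ =
      ≮⇒≥ λ smaller → none (X , Y , (s'-sep , s₁≤s' , s'≤s₂) , smaller)

  lambda-exists : ∀ {s₁ s₂} s → Between s₁ s₂ s → ∃ (IsLambda G s₁ s₂)
  lambda-exists s = lambda-exists-acc s (<-wellFounded (ord s))

smallSeparation⇒λ< : ∀ (G : Graph n) {Z₁ Z₂ m} → SmallSeparation (Graph.adj G) Z₁ Z₂ m →
                      ∃ λ l → IsLambda G (Z₁ , ⊤) (⊤ , Z₂) l × l < m
smallSeparation⇒λ< G {Z₁} {Z₂} (X , Y , sep , Z₁⊆X , Z₂⊆Y , ∣X∩Y∣<m) =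
  proj₁ λ-witness , proj₂ λ-witness ,
  ≤-<-trans (proj₂ (proj₂ λ-witness) (X , Y) XY-sep Z₁V≤XY XY≤VZ₂) ∣X∩Y∣<m
  where
  XY-sep : IsSep G (X , Y)
  XY-sep = isSeparation⇒isSep G sep
  Z₁V≤XY : (Z₁ , ⊤) ≤ˢ (X , Y)
  Z₁V≤XY = Z₁⊆X , λ _ → ∈⊤
  XY≤VZ₂ : (X , Y) ≤ˢ (⊤ , Z₂)
  XY≤VZ₂ = (λ _ → ∈⊤) , Z₂⊆Y
  λ-witness : ∃ (IsLambda G (Z₁ , ⊤) (⊤ , Z₂))
  λ-witness = lambda-exists G (X , Y) (XY-sep , Z₁V≤XY , XY≤VZ₂)

int-⊆ : ∀ (σ : List (Sepn n)) {s} → s ∈ₗ σ → int σ ⊆ proj₂ s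
int-⊆ ((_ , B) ∷ σ) (here refl) v∈ = proj₁ (x∈p∩q⁻ B (int σ) v∈)
int-⊆ ((_ , B) ∷ σ) (there s∈σ) v∈ = int-⊆ σ s∈σ (proj₂ (x∈p∩q⁻ B (int σ) v∈))

isSep-⊤ : ∀ (G : Graph n) Z → IsSep G (Z , ⊤)
isSep-⊤ G Z = cover⇒∪≡⊤ Z ⊤ (λ _ → inj₂ ∈⊤) , λ _ _ _ u∉⊤ _ _ _ → u∉⊤ ∈⊤

star-∷-⊤ : ∀ {G : Graph n} {σ Z} → IsStar G σ → Z ⊆ int σ → IsStar G ((Z , ⊤) ∷ σ)
star-∷-⊤ {G = G} {σ} {Z} (seps , star) Z⊆int = isSep-⊤ G Z ∷ seps , pairs
  where
  pairs : ∀ i j → i ≢ j → lookup ((Z , ⊤) ∷ σ) i ≤ˢ lookup ((Z , ⊤) ∷ σ) j *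
  pairs zero zero i≢j = contradiction refl i≢j
  pairs zero (suc j) _ = (λ z∈Z → int-⊆ σ (∈-lookup j) (Z⊆int z∈Z)) , (λ _ → ∈⊤)
  pairs (suc i) zero _ = (λ _ → ∈⊤) , (λ z∈Z → int-⊆ σ (∈-lookup i) (Z⊆int z∈Z))
  pairs (suc i) (suc j) i≢j = star i j (i≢j ∘ cong suc)

consec-linked-any : ∀ {A : Set} {R : A → A → Set} {Q : A × A → Set} xs → Linked R xs →
                    Any Q (consec xs) → Any (λ e → R (proj₁ e) (proj₂ e) × Q e) (consec xs)
consec-linked-any (x ∷ y ∷ ys) (r ∷ _) (here q) = here (r , q)
consec-linked-any (x ∷ y ∷ ys) (_ ∷ rs) (there qs) = there (consec-linked-any (y ∷ ys) rs qs)

module _ {G : Graph n} {k} (𝒯 : STree G k) where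
  open STree 𝒯

  V⊆proj₂-α : ∀ {s s'} → TEdge s s' → V s' ⊆ proj₂ (α s s')
  V⊆proj₂-α {s} {s'} ss' = int-⊆ (σ s') (∈-map⁺ (λ x → α x s') s∈nbrs)
    where
    s∈nbrs : s ∈ₗ nbrs s'
    s∈nbrs = ∈-filter⁺ (λ x → Bool.T? (tadj x s')) (∈-allFin s) (subst Bool.T (sym ss') tt)

  ∣V∩V∣≤ord-α : ∀ {s s'} → TEdge s s' → ∣ V s ∩ V s' ∣ ≤ ord (α s s')
  ∣V∩V∣≤ord-α {s} {s'} ss' = p⊆q⇒∣p∣≤∣q∣ λ v∈ → case x∈p∩q⁻ (V s) (V s') v∈ of λ
    { (v∈Vs , v∈Vs') →
      x∈p∩q⁺ (subst (λ r → _ ∈ proj₂ r) (α-inv s s' ss') (V⊆proj₂-α s's v∈Vs) , V⊆proj₂-α ss' v∈Vs') }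
    where
    s's : TEdge s' s
    s's = trans (tadj-sym s' s) ss'

  small-adhesion-on-path : ∀ {t t' P l m} → TPath t t' P → PathMin P l → l < m →
                             Any (λ e → ∣ V (proj₁ e) ∩ V (proj₂ e) ∣ < m) (consec P)
  small-adhesion-on-path {P = P} (_ , linked , _) (attained , _) l<m =
    Any.map (λ { (ss' , ord≡l) → ≤-<-trans (∣V∩V∣≤ord-α ss') (subst (_< _) (sym ord≡l) l<m) })
            (consec-linked-any P linked attained)

lemma5p6 : ∀ {n k : ℕ} (G : Graph n) (𝓕 : FamilyOfStars G) (𝒯 : STree G k) →
    IsStable 𝓕 → IsTame 𝒯 → IsOver 𝒯 𝓕 → IsFLean 𝒯 𝓕 → IsLeanTD 𝒯
lemma5p6 G 𝓕 𝒯 stable tame over lean m t t' Z₁ Z₂ Z₁⊆Vt Z₂⊆Vt' ∣Z₁∣≡m ∣Z₂∣≡m P tPt' =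
  Sum.map (dPaths⇒hasDisjointPaths G) small-adhesion (menger (Graph.adj G) Z₁ Z₂ m)
  where
  open STree 𝒯 using (V; σ)

  addable : ∀ {Z} t → Z ⊆ V t → Addable 𝒯 𝓕 t (Z , ⊤)
  addable t Z⊆Vt = stable (σ t) _ (over t) (isSep-⊤ G _) (star-∷-⊤ {G = G} (tame t) Z⊆Vt)

  small-adhesion : SmallSeparation (Graph.adj G) Z₁ Z₂ m →
                   Any (λ e → ∣ V (proj₁ e) ∩ V (proj₂ e) ∣ < m) (consec P)
  small-adhesion small with smallSeparation⇒λ< G small
  ... | l , l-is-λ , l<m
    with lean t t' Z₁ ⊤ Z₂ ⊤ (isSep-⊤ G Z₁) (isSep-⊤ G Z₂) ((λ _ → ∈⊤) , (λ _ → ∈⊤))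
              (addable t Z₁⊆Vt) (addable t' Z₂⊆Vt') l l-is-λ
  ...   | inj₁ ∣Z₁∣⊓∣Z₂∣≤l = contradiction m≤l (<⇒≱ l<m)
    where
    m≤l : m ≤ l
    m≤l = subst (_≤ l) (⊓-idem m) (subst₂ (λ a b → a ⊓ b ≤ l) ∣Z₁∣≡m ∣Z₂∣≡m ∣Z₁∣⊓∣Z₂∣≤l)
  ...   | inj₂ pathMin = small-adhesion-on-path 𝒯 tPt' (pathMin P tPt') l<m
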